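{- Let $\Omega$ be a set with $|\Omega|=5$, and let $G_1,G_2\in\mathcal{C}_5\cup\mathcal{K}_{2,3}$. Then $\mathcal{U}_{3,\Omega}=\mathcal{D}(G_1)\sqcap\mathcal{D}(G_2)$ if and only if $G_1,G_2\in\mathcal{C}_5$ and $E(G_1)\cup E(G_2)=E(K_\Omega)$.
   Context: Graphs are finite, simple, undirected; $\mathcal{D}(G)$ is the family of inclusion-minimal dominating sets of $G$ (a dominating set is $D\subseteq V(G)$ such that every vertex outside $D$ has a neighbour in $D$). $\mathcal{C}_5$ is the family of graphs with vertex set $\Omega$ isomorphic to the cycle $C_5$; $\mathcal{K}_{2,3}$ is the family of graphs with vertex set $\Omega$ isomorphic to $K_{2,3}$. $K_\Omega$ is the complete graph on $\Omega$. $\mathcal{U}_{3,\Omega}=\{A\subseteq\Omega:|A|=3\}$. $\mathcal{H}_1\sqcap\mathcal{H}_2$ is the family of inclusion-minimal sets among $\{A_1\cup A_2:A_1\in\mathcal{H}_1,A_2\in\mathcal{H}_2\}$. -}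

module Defs where

open import Data.Bool using (Bool; true; false; _∨_)
open import Data.Fin using (Fin; zero; suc)
open import Data.Fin.Subset using (Subset; _∈_; _∉_; _⊆_; _∪_; ∣_∣)
open import Data.Fin.Permutation using (Permutation′; _⟨$⟩ʳ_)
open import Data.Nat using (ℕ)
open import Data.Product using (Σ; ∃; ∃-syntax; _×_)
open import Data.Sum using (_⊎_)
open import Relation.Binary.PropositionalEquality using (_≡_; _≢_)
open import Relation.Nullary using (¬_)

Ω : Set
Ω = Fin 5

record Graph : Set where
  field
    adj    : Ω → Ω → Bool
    sym    : ∀ i j → adj i j ≡ adj j i
    irrefl : ∀ i → adj i i ≡ false
open Graph public

E : Graph → Ω → Ω → Set
E G i j = adj G i j ≡ true

-- Reference cycle C5 on 0-1-2-3-4-0.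
c5adj : Ω → Ω → Bool
c5adj zero (suc zero) = true
c5adj (suc zero) (suc (suc zero)) = true
c5adj (suc (suc zero)) (suc (suc (suc zero))) = true
c5adj (suc (suc (suc zero))) (suc (suc (suc (suc zero)))) = true
c5adj (suc (suc (suc (suc zero)))) zero = true
c5adj (suc zero) zero = true
c5adj (suc (suc zero)) (suc zero) = true
c5adj (suc (suc (suc zero))) (suc (suc zero)) = true
c5adj (suc (suc (suc (suc zero)))) (suc (suc (suc zero))) = true
c5adj zero (suc (suc (suc (suc zero)))) = true
c5adj _ _ = false

side : Ω → Bool
side zero = true
side (suc zero) = true
side _ = false

k23adj : Ω → Ω → Bool
k23adj i j with side i | side j
... | true  | false = true
... | false | true  = true
... | _     | _     = false

IsoTo : (Ω → Ω → Bool) → Graph → Set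
IsoTo h G = Σ (Permutation′ 5) λ π → ∀ i j → adj G i j ≡ h (π ⟨$⟩ʳ i) (π ⟨$⟩ʳ j)

InC5 : Graph → Set
InC5 = IsoTo c5adj

InK23 : Graph → Set
InK23 = IsoTo k23adj

Family : Set₁
Family = Subset 5 → Set

Dominating : Graph → Subset 5 → Set
Dominating G D = ∀ v → v ∉ D → ∃[ u ] (u ∈ D × E G u v)

𝒟 : Graph → Family
𝒟 G D = Dominating G D × (∀ D′ → Dominating G D′ → D′ ⊆ D → D′ ≡ D)

Joins : Family → Family → Family
Joins H₁ H₂ X = ∃[ A₁ ] ∃[ A₂ ] (H₁ A₁ × H₂ A₂ × X ≡ A₁ ∪ A₂)

_⊓_ : Family → Family → Family
(H₁ ⊓ H₂) X = Joins H₁ H₂ X × (∀ Y → Joins H₁ H₂ Y → Y ⊆ X → Y ≡ X)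

𝒰₃ : Family
𝒰₃ A = ∣ A ∣ ≡ 3

_≐_ : Family → Family → Set
H ≐ H′ = ∀ X → (H X → H′ X) × (H′ X → H X)

-- E(G₁) ∪ E(G₂) = E(K_Ω): every pair of distinct vertices is an edge of G₁ or G₂.
CoverComplete : Graph → Graph → Set
CoverComplete G₁ G₂ = ∀ i j → i ≢ j → E G₁ i j ⊎ E G₂ i j

-- Both sides of the equivalence are invariant under relabelling Ω simultaneously in G₁ and G₂:
-- a permutation acts on the subsets of Ω preserving unions, inclusions and cardinalities, and it
-- carries the minimal dominating sets of a graph to those of the relabelled graph. Relabelling by
-- the isomorphism from G₁ onto the reference C₅ or K₂,₃ turns G₂ into one of the 120 relabellings
-- of a reference graph, so the statement reduces to 4 × 120 finite instances, decided by
-- evaluation. Since domination is upward closed, a dominating set is minimal as soon as no single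
-- vertex can be removed from it, which keeps that evaluation cheap.
module Submission where

open import Defs hiding (sym)
open import Data.Bool using (Bool; true; false; if_then_else_)
open import Data.Bool.Properties using () renaming (_≟_ to _≟ᵇ_)
open import Data.Empty using (⊥-elim)
open import Data.Fin using (Fin)
open import Data.Fin.Permutation using (Permutation′; _⟨$⟩ʳ_; _⟨$⟩ˡ_; inverseˡ; inverseʳ)
open import Data.Fin.Properties using (all?; any?) renaming (_≟_ to _≟ᶠ_)
open import Data.Fin.Subset using (Subset; inside; outside; _∈_; _∉_; _⊆_; _∪_; _-_; ∣_∣)
open import Data.Fin.Subset.Properties
  using (_∈?_; _⊆?_; ⊆-antisym; x∈p∪q⁺; x∈p∪q⁻; x∈p∧x≢y⇒x∈p-y; x∈p⇒p-x⊂p; p─q⊆p)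
open import Data.List using (List; []; _∷_; filter; cartesianProductWith)
open import Data.List.Membership.Propositional using () renaming (_∈_ to _∈ˡ_)
open import Data.List.Membership.Propositional.Properties
  using (∈-filter⁺; ∈-filter⁻; ∈-cartesianProductWith⁺; ∈-cartesianProductWith⁻; ∈-allFin)
import Data.List.Relation.Unary.All as All
open import Data.List.Relation.Unary.Any as Any using (here; there)
open import Data.Nat using (ℕ; zero; suc)
import Data.Nat.Properties as ℕ
open import Algebra.Properties.CommutativeMonoid.Sum ℕ.+-0-commutativeMonoid
  using (sum; sum-cong-≗; sum-permute)
open import Data.Product using (_×_; _,_; proj₁; proj₂; swap; ∃-syntax)
open import Data.Sum as Sum using (_⊎_; inj₁; inj₂)
open import Data.Vec using (Vec; []; _∷_; lookup; tabulate)
open import Data.Vec.Properties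
  using (≡-dec; []=⇒lookup; lookup⇒[]=; lookup∘tabulate; tabulate∘lookup; tabulate-cong)
open import Function using (_∘_; _⇔_; mk⇔; Injective; Equivalence)
open import Relation.Binary.PropositionalEquality
  using (_≡_; refl; sym; trans; cong; cong₂; subst; module ≡-Reasoning)
open import Relation.Nullary using (¬_; Dec; yes; no; contradiction)
open import Relation.Nullary.Decidable
  using (map′; _×-dec_; _→-dec_; _⊎-dec_; ¬?; from-yes; decidable-stable)
open import Relation.Unary using (Pred; Decidable)

private
  variable
    n : ℕ

vectors : {A : Set} → List A → (n : ℕ) → List (Vec A n)
vectors xs zero    = [] ∷ []
vectors xs (suc n) = cartesianProductWith _∷_ xs (vectors xs n)

∈-vectors : {A : Set} {xs : List A} → (∀ x → x ∈ˡ xs) → (v : Vec A n) → v ∈ˡ vectors xs n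
∈-vectors complete []      = here refl
∈-vectors complete (x ∷ v) = ∈-cartesianProductWith⁺ _∷_ (complete x) (∈-vectors complete v)

all?-enumerated : ∀ {A : Set} {p} {P : Pred A p} {xs : List A} →
                  (∀ x → x ∈ˡ xs) → Decidable P → Dec (∀ x → P x)
all?-enumerated complete P? =
  map′ (λ ps x → All.lookup ps (complete x)) (λ p → All.tabulate λ {x} _ → p x) (All.all? P? _)

subsets : (n : ℕ) → List (Subset n)
subsets = vectors (inside ∷ outside ∷ [])

∈-subsets : (p : Subset n) → p ∈ˡ subsets n
∈-subsets = ∈-vectors λ { inside → here refl ; outside → there (here refl) }

allSubsets? : ∀ {p} {P : Pred (Subset n) p} → Decidable P → Dec (∀ p → P p)
allSubsets? = all?-enumerated ∈-subsets

allTuples? : ∀ {p} {P : Pred (Vec (Fin n) n) p} → Decidable P → Dec (∀ v → P v)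
allTuples? = all?-enumerated (∈-vectors ∈-allFin)

_≟ˢ_ : (p q : Subset n) → Dec (p ≡ q)
_≟ˢ_ = ≡-dec _≟ᵇ_

Minimal : ∀ {p} → Pred (Subset n) p → Pred (Subset n) p
Minimal H X = H X × (∀ Y → H Y → Y ⊆ X → Y ≡ X)

UpwardClosed : ∀ {p} → Pred (Subset n) p → Set p
UpwardClosed H = ∀ {X Y} → X ⊆ Y → H X → H Y

⊆-or-witness : (X Y : Subset n) → X ⊆ Y ⊎ ∃[ v ] (v ∈ X × v ∉ Y)
⊆-or-witness X Y with any? (λ v → v ∈? X ×-dec ¬? (v ∈? Y))
... | yes witness = inj₂ witness
... | no ¬witness = inj₁ λ {x} x∈X → decidable-stable (x ∈? Y) (λ x∉Y → ¬witness (x , x∈X , x∉Y))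

minimal⇔irredundant : ∀ {p} {H : Pred (Subset n) p} → UpwardClosed H →
                      ∀ X → Minimal H X ⇔ (H X × (∀ v → v ∈ X → ¬ H (X - v)))
minimal⇔irredundant {H = H} up X = mk⇔ to from
  where
  to : Minimal H X → H X × (∀ v → v ∈ X → ¬ H (X - v))
  to (hX , least) = hX , λ v v∈X hX-v →
    let (_ , w , w∈X , w∉X-v) = x∈p⇒p-x⊂p v∈X
    in w∉X-v (subst (w ∈_) (sym (least (X - v) hX-v (p─q⊆p X _))) w∈X)
  from : H X × (∀ v → v ∈ X → ¬ H (X - v)) → Minimal H X
  from (hX , irredundant) = hX , least
    where
    least : ∀ Y → H Y → Y ⊆ X → Y ≡ X
    least Y hY Y⊆X with ⊆-or-witness X Y
    ... | inj₁ X⊆Y = ⊆-antisym Y⊆X X⊆Y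
    ... | inj₂ (v , v∈X , v∉Y) = contradiction (up Y⊆X-v hY) (irredundant v v∈X)
      where
      Y⊆X-v : Y ⊆ X - v
      Y⊆X-v y∈Y = x∈p∧x≢y⇒x∈p-y (Y⊆X y∈Y) λ { refl → v∉Y y∈Y }

≐-sym : ∀ {H K} → H ≐ K → K ≐ H
≐-sym H≐K X = swap (H≐K X)

≐-trans : ∀ {H K L} → H ≐ K → K ≐ L → H ≐ L
≐-trans H≐K K≐L X = proj₁ (K≐L X) ∘ proj₁ (H≐K X) , proj₂ (H≐K X) ∘ proj₂ (K≐L X)

minimal-cong : ∀ {H K} → H ≐ K → Minimal H ≐ Minimal K
minimal-cong H≐K X =
  (λ (hX , least) → proj₁ (H≐K X) hX , λ Y kY → least Y (proj₂ (H≐K Y) kY)) ,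
  (λ (kX , least) → proj₂ (H≐K X) kX , λ Y hY → least Y (proj₁ (H≐K Y) hY))

joins-cong : ∀ {H₁ H₂ K₁ K₂} → H₁ ≐ K₁ → H₂ ≐ K₂ → Joins H₁ H₂ ≐ Joins K₁ K₂
joins-cong H₁≐K₁ H₂≐K₂ X =
  (λ (A₁ , A₂ , h₁ , h₂ , X≡) → A₁ , A₂ , proj₁ (H₁≐K₁ A₁) h₁ , proj₁ (H₂≐K₂ A₂) h₂ , X≡) ,
  (λ (A₁ , A₂ , k₁ , k₂ , X≡) → A₁ , A₂ , proj₂ (H₁≐K₁ A₁) k₁ , proj₂ (H₂≐K₂ A₂) k₂ , X≡)

⊓-cong : ∀ {H₁ H₂ K₁ K₂} → H₁ ≐ K₁ → H₂ ≐ K₂ → (H₁ ⊓ H₂) ≐ (K₁ ⊓ K₂)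
⊓-cong H₁≐K₁ H₂≐K₂ = minimal-cong (joins-cong H₁≐K₁ H₂≐K₂)

Decomposes𝒰₃ : Graph → Graph → Set
Decomposes𝒰₃ G₁ G₂ = 𝒰₃ ≐ (𝒟 G₁ ⊓ 𝒟 G₂)

ListedBy : ∀ {p} → Pred (Subset n) p → List (Subset n) → Set p
ListedBy H xs = ∀ X → H X ⇔ X ∈ˡ xs

filter-listed : ∀ {p} {H : Pred (Subset n) p} (H? : Decidable H) → ListedBy H (filter H? (subsets n))
filter-listed {n = n} H? X = mk⇔ (∈-filter⁺ H? (∈-subsets X)) (proj₂ ∘ ∈-filter⁻ H? {xs = subsets n})

minimal? : ∀ {p} {H : Pred (Subset n) p} {xs} → ListedBy H xs → Decidable (Minimal H)
minimal? {xs = xs} listed X =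
  map′ (Equivalence.from (listed X)) (Equivalence.to (listed X)) (Any.any? (X ≟ˢ_) xs) ×-dec
  map′ (λ below Y hY → All.lookup below (Equivalence.to (listed Y) hY))
       (λ below → All.tabulate λ {Y} Y∈xs → below Y (Equivalence.from (listed Y) Y∈xs))
       (All.all? (λ Y → Y ⊆? X →-dec Y ≟ˢ X) xs)

joins-listed : ∀ {H₁ H₂ xs ys} → ListedBy H₁ xs → ListedBy H₂ ys →
               ListedBy (Joins H₁ H₂) (cartesianProductWith _∪_ xs ys)
joins-listed {xs = xs} {ys} listed₁ listed₂ X = mk⇔ to from
  where
  to : Joins _ _ X → X ∈ˡ cartesianProductWith _∪_ xs ys
  to (A₁ , A₂ , h₁ , h₂ , refl) =
    ∈-cartesianProductWith⁺ _∪_ (Equivalence.to (listed₁ A₁) h₁) (Equivalence.to (listed₂ A₂) h₂)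
  from : X ∈ˡ cartesianProductWith _∪_ xs ys → Joins _ _ X
  from X∈ with ∈-cartesianProductWith⁻ _∪_ xs ys X∈
  ... | A₁ , A₂ , A₁∈ , A₂∈ , X≡ =
    A₁ , A₂ , Equivalence.from (listed₁ A₁) A₁∈ , Equivalence.from (listed₂ A₂) A₂∈ , X≡

⊓? : ∀ {H₁ H₂} → Decidable H₁ → Decidable H₂ → Decidable (H₁ ⊓ H₂)
⊓? H₁? H₂? = minimal? (joins-listed (filter-listed H₁?) (filter-listed H₂?))

𝒰₃≐? : ∀ {H} → Decidable H → Dec (𝒰₃ ≐ H)
𝒰₃≐? H? = allSubsets? λ X → ((∣ X ∣ ℕ.≟ 3) →-dec H? X) ×-dec (H? X →-dec (∣ X ∣ ℕ.≟ 3))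

Dominating? : (G : Graph) → Decidable (Dominating G)
Dominating? G D = all? λ v → ¬? (v ∈? D) →-dec any? λ u → u ∈? D ×-dec adj G u v ≟ᵇ true

dominating-upwardClosed : (G : Graph) → UpwardClosed (Dominating G)
dominating-upwardClosed G D⊆D′ dom v v∉D′ =
  let (u , u∈D , edge) = dom v (v∉D′ ∘ D⊆D′) in u , D⊆D′ u∈D , edge

𝒟? : (G : Graph) → Decidable (𝒟 G)
𝒟? G D = map′ (Equivalence.from (equiv D)) (Equivalence.to (equiv D))
              (Dominating? G D ×-dec all? λ v → v ∈? D →-dec ¬? (Dominating? G (D - v)))
  where
  equiv : ∀ D → 𝒟 G D ⇔ (Dominating G D × (∀ v → v ∈ D → ¬ Dominating G (D - v)))
  equiv = minimal⇔irredundant (dominating-upwardClosed G)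

decomposes𝒰₃? : (G₁ G₂ : Graph) → Dec (Decomposes𝒰₃ G₁ G₂)
decomposes𝒰₃? G₁ G₂ = 𝒰₃≐? (⊓? (𝒟? G₁) (𝒟? G₂))

CoverComplete? : (G₁ G₂ : Graph) → Dec (CoverComplete G₁ G₂)
CoverComplete? G₁ G₂ =
  all? λ i → all? λ j → ¬? (i ≟ᶠ j) →-dec (adj G₁ i j ≟ᵇ true ⊎-dec adj G₂ i j ≟ᵇ true)

preimage : (Fin n → Fin n) → Subset n → Subset n
preimage f X = tabulate (lookup X ∘ f)

∈-preimage : ∀ (f : Fin n → Fin n) {X i} → i ∈ preimage f X ⇔ f i ∈ X
∈-preimage f {X} {i} = mk⇔
  (λ i∈ → lookup⇒[]= (f i) X (trans (sym (lookup∘tabulate (lookup X ∘ f) i)) ([]=⇒lookup i∈)))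
  (λ fi∈ → lookup⇒[]= i _ (trans (lookup∘tabulate (lookup X ∘ f) i) ([]=⇒lookup fi∈)))

preimage-∘ : ∀ (f g : Fin n → Fin n) X → preimage f (preimage g X) ≡ preimage (g ∘ f) X
preimage-∘ f g X = tabulate-cong λ i → lookup∘tabulate (lookup X ∘ g) (f i)

preimage-identity : ∀ {f : Fin n → Fin n} → (∀ i → f i ≡ i) → ∀ X → preimage f X ≡ X
preimage-identity f≗id X = trans (tabulate-cong (cong (lookup X) ∘ f≗id)) (tabulate∘lookup X)

preimage-⊆ : ∀ (f : Fin n → Fin n) {X Y} → X ⊆ Y → preimage f X ⊆ preimage f Y
preimage-⊆ f X⊆Y = Equivalence.from (∈-preimage f) ∘ X⊆Y ∘ Equivalence.to (∈-preimage f)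

preimage-∪ : ∀ (f : Fin n → Fin n) X Y → preimage f (X ∪ Y) ≡ preimage f X ∪ preimage f Y
preimage-∪ f X Y = ⊆-antisym
  (λ i∈ → x∈p∪q⁺ (Sum.map (from (∈-preimage f {X})) (from (∈-preimage f {Y}))
                           (x∈p∪q⁻ X Y (to (∈-preimage f {X ∪ Y}) i∈))))
  (λ i∈ → from (∈-preimage f {X ∪ Y}) (x∈p∪q⁺ (Sum.map (to (∈-preimage f {X})) (to (∈-preimage f {Y}))
                                                 (x∈p∪q⁻ (preimage f X) (preimage f Y) i∈))))
  where open Equivalence

∣X∣≡sum : (X : Subset n) → ∣ X ∣ ≡ sum (λ i → if lookup X i then 1 else 0)
∣X∣≡sum []            = refl
∣X∣≡sum (inside  ∷ X) = cong suc (∣X∣≡sum X)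
∣X∣≡sum (outside ∷ X) = ∣X∣≡sum X

∣preimage∣ : ∀ (σ : Permutation′ n) X → ∣ preimage (σ ⟨$⟩ʳ_) X ∣ ≡ ∣ X ∣
∣preimage∣ σ X = begin
  ∣ preimage (σ ⟨$⟩ʳ_) X ∣                        ≡⟨ ∣X∣≡sum (preimage (σ ⟨$⟩ʳ_) X) ⟩
  sum (indicator ∘ lookup (preimage (σ ⟨$⟩ʳ_) X)) ≡⟨ sum-cong-≗ (cong indicator ∘ lookup∘tabulate σX) ⟩
  sum (indicator ∘ lookup X ∘ (σ ⟨$⟩ʳ_))         ≡⟨ sum-permute (indicator ∘ lookup X) σ ⟨
  sum (indicator ∘ lookup X)                      ≡⟨ ∣X∣≡sum X ⟨
  ∣ X ∣                                           ∎
  where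
  open ≡-Reasoning
  indicator : Bool → ℕ
  indicator b = if b then 1 else 0
  σX : Fin _ → Bool
  σX = lookup X ∘ (σ ⟨$⟩ʳ_)

⟨$⟩ʳ-injective : ∀ (σ : Permutation′ n) {i j} → σ ⟨$⟩ʳ i ≡ σ ⟨$⟩ʳ j → i ≡ j
⟨$⟩ʳ-injective σ e = trans (sym (inverseˡ σ)) (trans (cong (σ ⟨$⟩ˡ_) e) (inverseˡ σ))

⟨$⟩ˡ-injective : ∀ (σ : Permutation′ n) {i j} → σ ⟨$⟩ˡ i ≡ σ ⟨$⟩ˡ j → i ≡ j
⟨$⟩ˡ-injective σ e = trans (sym (inverseʳ σ)) (trans (cong (σ ⟨$⟩ʳ_) e) (inverseʳ σ))

_≅[_]_ : (Ω → Ω → Bool) → Permutation′ 5 → (Ω → Ω → Bool) → Set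
a′ ≅[ σ ] a = ∀ i j → a′ i j ≡ a (σ ⟨$⟩ʳ i) (σ ⟨$⟩ʳ j)

module _ (σ : Permutation′ 5) where

  private
    φ ψ : Subset 5 → Subset 5
    φ = preimage (σ ⟨$⟩ʳ_)
    ψ = preimage (σ ⟨$⟩ˡ_)

    ∈φ : ∀ {X i} → i ∈ φ X ⇔ σ ⟨$⟩ʳ i ∈ X
    ∈φ = ∈-preimage (σ ⟨$⟩ʳ_)

    φ∘ψ : ∀ X → φ (ψ X) ≡ X
    φ∘ψ X = trans (preimage-∘ (σ ⟨$⟩ʳ_) (σ ⟨$⟩ˡ_) X) (preimage-identity (λ _ → inverseˡ σ) X)

    ψ∘φ : ∀ X → ψ (φ X) ≡ X
    ψ∘φ X = trans (preimage-∘ (σ ⟨$⟩ˡ_) (σ ⟨$⟩ʳ_) X) (preimage-identity (λ _ → inverseʳ σ) X)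

    φ-injective : ∀ {X Y} → φ X ≡ φ Y → X ≡ Y
    φ-injective {X} {Y} φX≡φY = trans (sym (ψ∘φ X)) (trans (cong ψ φX≡φY) (ψ∘φ Y))

    φ-reflects-⊆ : ∀ {X Y} → φ X ⊆ φ Y → X ⊆ Y
    φ-reflects-⊆ {X} {Y} φX⊆φY =
      subst (_⊆ Y) (ψ∘φ X) (subst (ψ (φ X) ⊆_) (ψ∘φ Y) (preimage-⊆ (σ ⟨$⟩ˡ_) φX⊆φY))

  ≐-reflect : ∀ {H K} → (H ∘ φ) ≐ (K ∘ φ) → H ≐ K
  ≐-reflect {H} {K} e X =
    subst (λ Y → H Y → K Y) (φ∘ψ X) (proj₁ (e (ψ X))) ,
    subst (λ Y → K Y → H Y) (φ∘ψ X) (proj₂ (e (ψ X)))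

  minimal-preimage : ∀ H → (Minimal H ∘ φ) ≐ Minimal (H ∘ φ)
  minimal-preimage H X = to , from
    where
    to : Minimal H (φ X) → Minimal (H ∘ φ) X
    to (hX , least) = hX , λ Y hY Y⊆X → φ-injective (least (φ Y) hY (preimage-⊆ (σ ⟨$⟩ʳ_) Y⊆X))
    from : Minimal (H ∘ φ) X → Minimal H (φ X)
    from (hX , least) = hX , λ Z hZ Z⊆φX →
      let Z≡φψZ = sym (φ∘ψ Z)
          ψZ⊆X  = φ-reflects-⊆ (subst (_⊆ φ X) Z≡φψZ Z⊆φX)
      in trans Z≡φψZ (cong φ (least (ψ Z) (subst H Z≡φψZ hZ) ψZ⊆X))

  joins-preimage : ∀ H₁ H₂ → (Joins H₁ H₂ ∘ φ) ≐ Joins (H₁ ∘ φ) (H₂ ∘ φ)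
  joins-preimage H₁ H₂ X = to , from
    where
    to : Joins H₁ H₂ (φ X) → Joins (H₁ ∘ φ) (H₂ ∘ φ) X
    to (B₁ , B₂ , h₁ , h₂ , φX≡B₁∪B₂) =
      ψ B₁ , ψ B₂ , subst H₁ (sym (φ∘ψ B₁)) h₁ , subst H₂ (sym (φ∘ψ B₂)) h₂ , φ-injective (begin
        φ X                 ≡⟨ φX≡B₁∪B₂ ⟩
        B₁ ∪ B₂             ≡⟨ cong₂ _∪_ (φ∘ψ B₁) (φ∘ψ B₂) ⟨
        φ (ψ B₁) ∪ φ (ψ B₂) ≡⟨ preimage-∪ (σ ⟨$⟩ʳ_) (ψ B₁) (ψ B₂) ⟨
        φ (ψ B₁ ∪ ψ B₂)     ∎)
      where open ≡-Reasoning
    from : Joins (H₁ ∘ φ) (H₂ ∘ φ) X → Joins H₁ H₂ (φ X)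
    from (A₁ , A₂ , h₁ , h₂ , X≡) = φ A₁ , φ A₂ , h₁ , h₂ , trans (cong φ X≡) (preimage-∪ (σ ⟨$⟩ʳ_) A₁ A₂)

  ⊓-preimage : ∀ H₁ H₂ → ((H₁ ⊓ H₂) ∘ φ) ≐ ((H₁ ∘ φ) ⊓ (H₂ ∘ φ))
  ⊓-preimage H₁ H₂ = ≐-trans (minimal-preimage (Joins H₁ H₂)) (minimal-cong (joins-preimage H₁ H₂))

  𝒰₃-preimage : (𝒰₃ ∘ φ) ≐ 𝒰₃
  𝒰₃-preimage X = trans (sym (∣preimage∣ σ X)) , trans (∣preimage∣ σ X)

  module _ {G′ G : Graph} (G′≅G : adj G′ ≅[ σ ] adj G) where

    dominating-preimage : (Dominating G′ ∘ φ) ≐ Dominating G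
    dominating-preimage D = to , from
      where
      to : Dominating G′ (φ D) → Dominating G D
      to dom v v∉D =
        let (u , u∈ , edge) = dom (σ ⟨$⟩ˡ v) (v∉D ∘ subst (_∈ D) (inverseʳ σ) ∘ Equivalence.to ∈φ)
        in σ ⟨$⟩ʳ u , Equivalence.to ∈φ u∈ ,
           trans (cong (adj G _) (sym (inverseʳ σ))) (trans (sym (G′≅G u _)) edge)
      from : Dominating G D → Dominating G′ (φ D)
      from dom v v∉φD =
        let (u , u∈D , edge) = dom (σ ⟨$⟩ʳ v) (v∉φD ∘ Equivalence.from ∈φ)
        in σ ⟨$⟩ˡ u , Equivalence.from ∈φ (subst (_∈ D) (sym (inverseʳ σ)) u∈D) ,
           trans (G′≅G _ v) (trans (cong (λ w → adj G w _) (inverseʳ σ)) edge)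

    𝒟-preimage : (𝒟 G′ ∘ φ) ≐ 𝒟 G
    𝒟-preimage = ≐-trans (minimal-preimage (Dominating G′)) (minimal-cong dominating-preimage)

  module _ {G₁′ G₂′ G₁ G₂ : Graph}
           (G₁′≅G₁ : adj G₁′ ≅[ σ ] adj G₁) (G₂′≅G₂ : adj G₂′ ≅[ σ ] adj G₂) where

    decomposes-invariant : Decomposes𝒰₃ G₁′ G₂′ ⇔ Decomposes𝒰₃ G₁ G₂
    decomposes-invariant = mk⇔
      (λ d → ≐-trans (≐-sym 𝒰₃-preimage) (≐-trans (d ∘ φ) meet))
      (λ d → ≐-reflect (≐-trans 𝒰₃-preimage (≐-trans d (≐-sym meet))))
      where
      meet : ((𝒟 G₁′ ⊓ 𝒟 G₂′) ∘ φ) ≐ (𝒟 G₁ ⊓ 𝒟 G₂)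
      meet = ≐-trans (⊓-preimage (𝒟 G₁′) (𝒟 G₂′))
                     (⊓-cong (𝒟-preimage {G₁′} {G₁} G₁′≅G₁) (𝒟-preimage {G₂′} {G₂} G₂′≅G₂))

    cover-invariant : CoverComplete G₁′ G₂′ ⇔ CoverComplete G₁ G₂
    cover-invariant = mk⇔ to from
      where
      unrelabel : ∀ {G′ G} → adj G′ ≅[ σ ] adj G → ∀ {i j} → E G′ (σ ⟨$⟩ˡ i) (σ ⟨$⟩ˡ j) → E G i j
      unrelabel {G = G} G′≅G {i} {j} e =
        trans (sym (cong₂ (adj G) (inverseʳ σ) (inverseʳ σ))) (trans (sym (G′≅G _ _)) e)
      to : CoverComplete G₁′ G₂′ → CoverComplete G₁ G₂
      to cover i j i≢j =
        Sum.map (unrelabel {G₁′} {G₁} G₁′≅G₁) (unrelabel {G₂′} {G₂} G₂′≅G₂)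
                (cover _ _ (i≢j ∘ ⟨$⟩ˡ-injective σ))
      from : CoverComplete G₁ G₂ → CoverComplete G₁′ G₂′
      from cover i j i≢j =
        Sum.map (trans (G₁′≅G₁ i j)) (trans (G₂′≅G₂ i j)) (cover _ _ (i≢j ∘ ⟨$⟩ʳ-injective σ))

relabel : (Ω → Ω) → Graph → Graph
relabel f G = record
  { adj    = λ i j → adj G (f i) (f j)
  ; sym    = λ i j → Graph.sym G (f i) (f j)
  ; irrefl = λ i → irrefl G (f i)
  }

C₅ : Graph
C₅ = record
  { adj    = c5adj
  ; sym    = from-yes (all? λ i → all? λ j → c5adj i j ≟ᵇ c5adj j i)
  ; irrefl = from-yes (all? λ i → c5adj i i ≟ᵇ false)
  }

K₂₃ : Graph
K₂₃ = record
  { adj    = k23adj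
  ; sym    = from-yes (all? λ i → all? λ j → k23adj i j ≟ᵇ k23adj j i)
  ; irrefl = from-yes (all? λ i → k23adj i i ≟ᵇ false)
  }

Injective? : (f : Fin n → Fin n) → Dec (Injective _≡_ _≡_ f)
Injective? f =
  map′ (λ inj {i} {j} → inj i j) (λ inj i j → inj) (all? λ i → all? λ j → f i ≟ᶠ f j →-dec i ≟ᶠ j)

_⇔?_ : ∀ {a b} {A : Set a} {B : Set b} → Dec A → Dec B → Dec (A ⇔ B)
A? ⇔? B? = map′ (λ (f , g) → mk⇔ f g) (λ e → Equivalence.to e , Equivalence.from e)
                ((A? →-dec B?) ×-dec (B? →-dec A?))

-- Injective tuples stand in for the permutations of Ω, which cannot be enumerated directly.
ForAllRelabellings : ((Ω → Ω) → Set) → Set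
ForAllRelabellings P = ∀ v → Injective _≡_ _≡_ (lookup v) → P (lookup v)

allRelabellings? : ∀ {P} → (∀ f → Dec (P f)) → Dec (ForAllRelabellings P)
allRelabellings? P? = allTuples? λ v → Injective? (lookup v) →-dec P? (lookup v)

C₅-C₅-check : ForAllRelabellings λ f → Decomposes𝒰₃ C₅ (relabel f C₅) ⇔ CoverComplete C₅ (relabel f C₅)
C₅-C₅-check = from-yes (allRelabellings? λ f →
  decomposes𝒰₃? C₅ (relabel f C₅) ⇔? CoverComplete? C₅ (relabel f C₅))

C₅-K₂₃-check : ForAllRelabellings λ f → ¬ Decomposes𝒰₃ C₅ (relabel f K₂₃)
C₅-K₂₃-check = from-yes (allRelabellings? λ f → ¬? (decomposes𝒰₃? C₅ (relabel f K₂₃)))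

K₂₃-C₅-check : ForAllRelabellings λ f → ¬ Decomposes𝒰₃ K₂₃ (relabel f C₅)
K₂₃-C₅-check = from-yes (allRelabellings? λ f → ¬? (decomposes𝒰₃? K₂₃ (relabel f C₅)))

K₂₃-K₂₃-check : ForAllRelabellings λ f → ¬ Decomposes𝒰₃ K₂₃ (relabel f K₂₃)
K₂₃-K₂₃-check = from-yes (allRelabellings? λ f → ¬? (decomposes𝒰₃? K₂₃ (relabel f K₂₃)))

align : ∀ {G H} (π₁ π₂ : Permutation′ 5) → adj G ≅[ π₂ ] adj H →
        ∃[ v ] (Injective _≡_ _≡_ (lookup v) × adj G ≅[ π₁ ] adj (relabel (lookup v) H))
align {H = H} π₁ π₂ G≅H =
  v , v-injective , λ i j → trans (G≅H i j) (sym (cong₂ (adj H) (v∘π₁ i) (v∘π₁ j)))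
  where
  f : Ω → Ω
  f i = π₂ ⟨$⟩ʳ (π₁ ⟨$⟩ˡ i)
  v : Vec Ω 5
  v = tabulate f
  v∘π₁ : ∀ i → lookup v (π₁ ⟨$⟩ʳ i) ≡ π₂ ⟨$⟩ʳ i
  v∘π₁ i = trans (lookup∘tabulate f (π₁ ⟨$⟩ʳ i)) (cong (π₂ ⟨$⟩ʳ_) (inverseˡ π₁))
  v-injective : Injective _≡_ _≡_ (lookup v)
  v-injective {i} {j} e = ⟨$⟩ˡ-injective π₁ (⟨$⟩ʳ-injective π₂
    (trans (sym (lookup∘tabulate f i)) (trans e (lookup∘tabulate f j))))

-- Relabelling both graphs by π₁⁻¹ turns G₁ into H₁, and G₂ into a relabelling of H₂.
to-reference : ∀ H₁ H₂ {G₁ G₂} → IsoTo (adj H₁) G₁ → IsoTo (adj H₂) G₂ →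
  ∃[ v ] (Injective _≡_ _≡_ (lookup v) ×
          (Decomposes𝒰₃ G₁ G₂ ⇔ Decomposes𝒰₃ H₁ (relabel (lookup v) H₂)) ×
          (CoverComplete G₁ G₂ ⇔ CoverComplete H₁ (relabel (lookup v) H₂)))
to-reference H₁ H₂ {G₁} {G₂} (π₁ , G₁≅H₁) (π₂ , G₂≅H₂) =
  let (v , v-injective , G₂≅) = align {G₂} {H₂} π₁ π₂ G₂≅H₂
      H₂′ : Graph
      H₂′ = relabel (lookup v) H₂
  in v , v-injective ,
     decomposes-invariant π₁ {G₁} {G₂} {H₁} {H₂′} G₁≅H₁ G₂≅ ,
     cover-invariant π₁ {G₁} {G₂} {H₁} {H₂′} G₁≅H₁ G₂≅

C₅-decomposes⇔cover : ∀ G₁ G₂ → InC5 G₁ → InC5 G₂ → Decomposes𝒰₃ G₁ G₂ ⇔ CoverComplete G₁ G₂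
C₅-decomposes⇔cover G₁ G₂ c₁ c₂ =
  let (v , v-injective , decomposes⇔ , cover⇔) = to-reference C₅ C₅ {G₁} {G₂} c₁ c₂
  in mk⇔ (from cover⇔ ∘ to (C₅-C₅-check v v-injective) ∘ to decomposes⇔)
         (from decomposes⇔ ∘ from (C₅-C₅-check v v-injective) ∘ to cover⇔)
  where open Equivalence

no-decomposition : ∀ H₁ H₂ G₁ G₂ → ForAllRelabellings (λ f → ¬ Decomposes𝒰₃ H₁ (relabel f H₂)) →
                   IsoTo (adj H₁) G₁ → IsoTo (adj H₂) G₂ → ¬ Decomposes𝒰₃ G₁ G₂
no-decomposition H₁ H₂ G₁ G₂ check G₁≅H₁ G₂≅H₂ =
  let (v , v-injective , decomposes⇔ , _) = to-reference H₁ H₂ {G₁} {G₂} G₁≅H₁ G₂≅H₂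
  in check v v-injective ∘ Equivalence.to decomposes⇔

proposition4p13 : (G₁ G₂ : Graph) →
    InC5 G₁ ⊎ InK23 G₁ → InC5 G₂ ⊎ InK23 G₂ →
    (𝒰₃ ≐ (𝒟 G₁ ⊓ 𝒟 G₂) → InC5 G₁ × InC5 G₂ × CoverComplete G₁ G₂) ×
    (InC5 G₁ × InC5 G₂ × CoverComplete G₁ G₂ → 𝒰₃ ≐ (𝒟 G₁ ⊓ 𝒟 G₂))
proposition4p13 G₁ G₂ G₁∈ G₂∈ = forward G₁∈ G₂∈ , backward
  where
  forward : InC5 G₁ ⊎ InK23 G₁ → InC5 G₂ ⊎ InK23 G₂ → Decomposes𝒰₃ G₁ G₂ →
            InC5 G₁ × InC5 G₂ × CoverComplete G₁ G₂
  forward (inj₁ c₁) (inj₁ c₂) d = c₁ , c₂ , Equivalence.to (C₅-decomposes⇔cover G₁ G₂ c₁ c₂) d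
  forward (inj₁ c₁) (inj₂ k₂) d = ⊥-elim (no-decomposition C₅ K₂₃ G₁ G₂ C₅-K₂₃-check c₁ k₂ d)
  forward (inj₂ k₁) (inj₁ c₂) d = ⊥-elim (no-decomposition K₂₃ C₅ G₁ G₂ K₂₃-C₅-check k₁ c₂ d)
  forward (inj₂ k₁) (inj₂ k₂) d = ⊥-elim (no-decomposition K₂₃ K₂₃ G₁ G₂ K₂₃-K₂₃-check k₁ k₂ d)
  backward : InC5 G₁ × InC5 G₂ × CoverComplete G₁ G₂ → Decomposes𝒰₃ G₁ G₂
  backward (c₁ , c₂ , cover) = Equivalence.from (C₅-decomposes⇔cover G₁ G₂ c₁ c₂) cover
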